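{- Let $\lambda$ be a Young diagram with $k$ rows of lengths $\lambda_1\ge\dots\ge\lambda_k>0$, and let $T$ be an X-diagram of shape $\lambda$ whose bottom row is not a zero-row. Let $j$ be the index of the pivot column of $T$. Then for every $i$ with $j<i\le\lambda_k$: if the top $k-1$ entries of column $i$ contain strictly more 1s than the top $k-1$ entries of column $j$, then $T(k,i)=1$; and if they contain strictly fewer 1s than the top $k-1$ entries of column $j$, then $T(k,i)=0$.
   Context: Young diagrams are in English notation: rows $1,\dots,k$ from top to bottom, left-justified, cells $(i,j)$ with $1\le j\le\lambda_i$; $T(i,j)$ is the entry in cell $(i,j)$. A diagram is a filling of the cells with 0s and 1s. An X-diagram is a diagram with no rows $i<i'$ and columns $j<j'$ (all four cells in the shape) such that the entries $T(i,j),T(i,j'),T(i',j),T(i',j')$ equal $1,0,0,1$ or $0,1,1,0$. A zero-row is a row of 0s. The pivot column of $T$ is defined as follows: among the columns $j\in\{1,\dots,\lambda_k\}$ with $T(k,j)=1$, consider those having the maximal number of 0s, and take the leftmost of these (it exists iff the bottom row is not a zero-row). -}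

module Defs where

open import Data.Nat using (ℕ; zero; suc; _+_; _∸_; _≤_; _<_)
open import Data.Bool using (Bool; true; false)
open import Data.Sum using (_⊎_)
open import Data.Product using (_×_; ∃-syntax)
open import Relation.Binary.PropositionalEquality using (_≡_; _≢_)
open import Relation.Nullary using (¬_)

-- Conventions: rows and columns are 1-indexed natural numbers.
-- A Young diagram with k rows is given by k and a row-length function
-- lam : ℕ → ℕ (only values lam 1 … lam k matter), with
-- lam 1 ≥ … ≥ lam k > 0.
record YoungDiagram : Set where
  field
    k       : ℕ
    lam     : ℕ → ℕ
    k-pos   : 1 ≤ k
    decr    : ∀ i → 1 ≤ i → i < k → lam (suc i) ≤ lam i
    last-pos : 1 ≤ lam k

open YoungDiagram public

InShape : YoungDiagram → ℕ → ℕ → Set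
InShape Y i j = (1 ≤ i × i ≤ k Y) × (1 ≤ j × j ≤ lam Y i)

-- A filling: entry T i j ∈ {0,1}, encoded as Bool (true = 1, false = 0).
-- Values outside the shape are irrelevant.
Filling : Set
Filling = ℕ → ℕ → Bool

IsXDiagram : YoungDiagram → Filling → Set
IsXDiagram Y T =
  ∀ i i' j j' → i < i' → j < j' →
    InShape Y i j → InShape Y i j' → InShape Y i' j → InShape Y i' j' →
    ¬ ((T i j ≡ true × T i j' ≡ false × T i' j ≡ false × T i' j' ≡ true)
       ⊎ (T i j ≡ false × T i j' ≡ true × T i' j ≡ true × T i' j' ≡ false))

onesUpTo : Filling → ℕ → ℕ → ℕ
onesUpTo T j zero = 0
onesUpTo T j (suc m) with T (suc m) j
... | true  = suc (onesUpTo T j m)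
... | false = onesUpTo T j m

zerosUpTo : Filling → ℕ → ℕ → ℕ
zerosUpTo T j zero = 0
zerosUpTo T j (suc m) with T (suc m) j
... | true  = zerosUpTo T j m
... | false = suc (zerosUpTo T j m)

IsZeroRow : YoungDiagram → Filling → ℕ → Set
IsZeroRow Y T i = ∀ j → 1 ≤ j → j ≤ lam Y i → T i j ≡ false

-- number of 0s in column j (for 1 ≤ j ≤ lam k the column has all k cells)
zerosInColumn : YoungDiagram → Filling → ℕ → ℕ
zerosInColumn Y T j = zerosUpTo T j (k Y)

IsPivotColumn : YoungDiagram → Filling → ℕ → Set
IsPivotColumn Y T j =
  (1 ≤ j × j ≤ lam Y (k Y)) × T (k Y) j ≡ true ×
  (∀ j' → 1 ≤ j' → j' ≤ lam Y (k Y) → T (k Y) j' ≡ true →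
     zerosInColumn Y T j' ≤ zerosInColumn Y T j) ×
  (∀ j' → 1 ≤ j' → j' < j → T (k Y) j' ≡ true →
     zerosInColumn Y T j' < zerosInColumn Y T j)

module Submission where

-- Let K be the number of rows, j the pivot column and j < i ≤ λ_K.
-- Only the bottom entry T(K,i) is unknown, so each claim is its contrapositive:
--   * If T(K,i) = 0, then (since T(K,j) = 1) the X-condition applied to the
--     rectangle on rows r < K and columns j < i shows that every 1 in the top
--     K-1 entries of column i is matched by a 1 in column j; hence column i
--     has at most as many 1s there as column j.
--   * If T(K,i) = 1, then maximality of the pivot gives zeros(i) ≤ zeros(j)
--     over all K rows; both bottom entries are 1, so the same holds over the
--     top K-1 rows, and since 0s and 1s add up to K-1 in every column,
--     column i has at least as many 1s there as column j.

open import Defs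
open import Data.Nat using (ℕ; zero; suc; _+_; _∸_; _≤_; _<_; _>_; z≤n; s≤s)
open import Data.Nat.Properties
  using (≤-refl; ≤-trans; <⇒≤; <-≤-trans; <⇒≱; m≤n⇒m≤1+n; +-suc; +-identityʳ;
         m+[n∸m]≡n; m<m+n; m+n∸m≡n; ∸-monoʳ-≤)
open import Data.Bool using (true; false)
open import Data.Product using (_×_; _,_)
open import Data.Sum using (inj₂)
open import Data.Empty using (⊥-elim)
open import Relation.Binary.PropositionalEquality
  using (_≡_; refl; sym; trans; cong; subst₂; module ≡-Reasoning)
open import Relation.Nullary using (¬_)

onesUpTo-mono : (T : Filling) (c c' m : ℕ) →
  (∀ r → 1 ≤ r → r ≤ m → T r c ≡ true → T r c' ≡ true) →
  onesUpTo T c m ≤ onesUpTo T c' m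
onesUpTo-mono T c c' zero matched = z≤n
onesUpTo-mono T c c' (suc m) matched
  with onesUpTo-mono T c c' m (λ r r≥1 r≤m → matched r r≥1 (m≤n⇒m≤1+n r≤m))
     | T (suc m) c in top | T (suc m) c' in top'
... | below | true  | true  = s≤s below
... | below | false | true  = m≤n⇒m≤1+n below
... | below | false | false = below
... | _     | true  | false with trans (sym top') (matched (suc m) (s≤s z≤n) ≤-refl top)
...   | ()

zeros+ones≡ : (T : Filling) (c m : ℕ) → zerosUpTo T c m + onesUpTo T c m ≡ m
zeros+ones≡ T c zero = refl
zeros+ones≡ T c (suc m) with T (suc m) c
... | true  = trans (+-suc _ _) (cong suc (zeros+ones≡ T c m))
... | false = cong suc (zeros+ones≡ T c m)

ones≡m∸zeros : (T : Filling) (c m : ℕ) → onesUpTo T c m ≡ m ∸ zerosUpTo T c m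
ones≡m∸zeros T c m = begin
  onesUpTo T c m                                       ≡⟨ sym (m+n∸m≡n (zerosUpTo T c m) _) ⟩
  (zerosUpTo T c m + onesUpTo T c m) ∸ zerosUpTo T c m ≡⟨ cong (_∸ zerosUpTo T c m) (zeros+ones≡ T c m) ⟩
  m ∸ zerosUpTo T c m                                  ∎
  where open ≡-Reasoning

zeros-≤⇒ones-≥ : (T : Filling) (c c' m : ℕ) →
  zerosUpTo T c m ≤ zerosUpTo T c' m → onesUpTo T c' m ≤ onesUpTo T c m
zeros-≤⇒ones-≥ T c c' m fewerZeros =
  subst₂ _≤_ (sym (ones≡m∸zeros T c' m)) (sym (ones≡m∸zeros T c m))
         (∸-monoʳ-≤ m fewerZeros)

zeros-drop-bottom-one : (T : Filling) (c K : ℕ) → 1 ≤ K → T K c ≡ true →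
  zerosUpTo T c K ≡ zerosUpTo T c (K ∸ 1)
zeros-drop-bottom-one T c (suc m) _ bottomOne rewrite bottomOne = refl

≤∸1⇒< : ∀ {r K} → 1 ≤ K → r ≤ K ∸ 1 → r < K
≤∸1⇒< {K = suc m} _ r≤m = s≤s r≤m

lam-last-≤ : (Y : YoungDiagram) (r : ℕ) → 1 ≤ r → r ≤ k Y → lam Y (k Y) ≤ lam Y r
lam-last-≤ Y r r≥1 r≤k = fromDistance (k Y ∸ r) r r≥1 (m+[n∸m]≡n r≤k)
  where
  fromDistance : ∀ d r → 1 ≤ r → r + d ≡ k Y → lam Y (k Y) ≤ lam Y r
  fromDistance zero r _ r+0≡k rewrite sym r+0≡k | +-identityʳ r = ≤-refl
  fromDistance (suc d) r r≥1 r+d+1≡k =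
    ≤-trans (fromDistance d (suc r) (s≤s z≤n) (trans (sym (+-suc r d)) r+d+1≡k))
            (decr Y r r≥1 (subst₂ _<_ refl r+d+1≡k (m<m+n r (s≤s z≤n))))

inShape-short-column : (Y : YoungDiagram) (r c : ℕ) →
  1 ≤ r → r ≤ k Y → 1 ≤ c → c ≤ lam Y (k Y) → InShape Y r c
inShape-short-column Y r c r≥1 r≤k c≥1 c≤λ =
  (r≥1 , r≤k) , (c≥1 , ≤-trans c≤λ (lam-last-≤ Y r r≥1 r≤k))

upper-left-forced : (Y : YoungDiagram) (T : Filling) → IsXDiagram Y T →
  (r r' c c' : ℕ) → r < r' → c < c' →
  InShape Y r c → InShape Y r c' → InShape Y r' c → InShape Y r' c' →
  T r' c ≡ true → T r' c' ≡ false → T r c' ≡ true → T r c ≡ true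
upper-left-forced Y T X r r' c c' r<r' c<c' s₁ s₂ s₃ s₄ lowerLeft lowerRight upperRight
  with T r c in upperLeft
... | true  = refl
... | false = ⊥-elim (X r r' c c' r<r' c<c' s₁ s₂ s₃ s₄
                        (inj₂ (upperLeft , upperRight , lowerLeft , lowerRight)))

bottom-one-zero⇒fewer-ones : (Y : YoungDiagram) (T : Filling) → IsXDiagram Y T →
  (c c' : ℕ) → 1 ≤ c → c < c' → c' ≤ lam Y (k Y) →
  T (k Y) c ≡ true → T (k Y) c' ≡ false →
  onesUpTo T c' (k Y ∸ 1) ≤ onesUpTo T c (k Y ∸ 1)
bottom-one-zero⇒fewer-ones Y T X c c' c≥1 c<c' c'≤λ bottomOne bottomZero =
  onesUpTo-mono T c' c (k Y ∸ 1) matched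
  where
  K = k Y
  c≤λ = <⇒≤ (<-≤-trans c<c' c'≤λ)
  c'≥1 = ≤-trans c≥1 (<⇒≤ c<c')
  matched : ∀ r → 1 ≤ r → r ≤ K ∸ 1 → T r c' ≡ true → T r c ≡ true
  matched r r≥1 r≤K-1 = upper-left-forced Y T X r K c c' r<K c<c'
    (inShape-short-column Y r c  r≥1 (<⇒≤ r<K) c≥1  c≤λ)
    (inShape-short-column Y r c' r≥1 (<⇒≤ r<K) c'≥1 c'≤λ)
    (inShape-short-column Y K c  (k-pos Y) ≤-refl c≥1  c≤λ)
    (inShape-short-column Y K c' (k-pos Y) ≤-refl c'≥1 c'≤λ)
    bottomOne bottomZero
    where r<K = ≤∸1⇒< (k-pos Y) r≤K-1

-- A column c' ≤ λ_K with bottom entry 1 has, above the bottom row, at least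
-- as many 1s as the pivot column, since it has at most as many 0s.
bottom-one⇒more-ones : (Y : YoungDiagram) (T : Filling) (j : ℕ) → IsPivotColumn Y T j →
  (c' : ℕ) → 1 ≤ c' → c' ≤ lam Y (k Y) → T (k Y) c' ≡ true →
  onesUpTo T j (k Y ∸ 1) ≤ onesUpTo T c' (k Y ∸ 1)
bottom-one⇒more-ones Y T j (_ , pivotOne , maximal , _) c' c'≥1 c'≤λ bottomOne =
  zeros-≤⇒ones-≥ T c' j (k Y ∸ 1)
    (subst₂ _≤_ (zeros-drop-bottom-one T c' (k Y) (k-pos Y) bottomOne)
                (zeros-drop-bottom-one T j  (k Y) (k-pos Y) pivotOne)
                (maximal c' c'≥1 c'≤λ bottomOne))

lemma3p6 : (Y : YoungDiagram) (T : Filling) → IsXDiagram Y T →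
    ¬ IsZeroRow Y T (k Y) →
    (j : ℕ) → IsPivotColumn Y T j →
    (i : ℕ) → j < i → i ≤ lam Y (k Y) →
      (onesUpTo T i (k Y ∸ 1) > onesUpTo T j (k Y ∸ 1) → T (k Y) i ≡ true)
      × (onesUpTo T i (k Y ∸ 1) < onesUpTo T j (k Y ∸ 1) → T (k Y) i ≡ false)
lemma3p6 Y T X _ j pivot@((j≥1 , _) , pivotOne , _) i j<i i≤λ =
  moreOnes⇒one , fewerOnes⇒zero
  where
  moreOnes⇒one : onesUpTo T i (k Y ∸ 1) > onesUpTo T j (k Y ∸ 1) → T (k Y) i ≡ true
  moreOnes⇒one more with T (k Y) i in bottom
  ... | true  = refl
  ... | false = ⊥-elim (<⇒≱ more
        (bottom-one-zero⇒fewer-ones Y T X j i j≥1 j<i i≤λ pivotOne bottom))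

  fewerOnes⇒zero : onesUpTo T i (k Y ∸ 1) < onesUpTo T j (k Y ∸ 1) → T (k Y) i ≡ false
  fewerOnes⇒zero fewer with T (k Y) i in bottom
  ... | false = refl
  ... | true  = ⊥-elim (<⇒≱ fewer
        (bottom-one⇒more-ones Y T j pivot i (≤-trans j≥1 (<⇒≤ j<i)) i≤λ bottom))
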